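{- Let $n\ge3$ and let $\mathcal{F}$ be an $n\times n$ Ferrers diagram such that the pair $(\mathcal{F},2)$ is MDS-constructible. Then the pair $(\mathcal{F},3)$ is also MDS-constructible.
   Context: $[i]=\{1,\dots,i\}$. An $n\times m$ Ferrers diagram is a subset $\mathcal{F}\subseteq[n]\times[m]$ such that $(1,1),(n,m)\in\mathcal{F}$; if $(i,j)\in\mathcal{F}$ and $j<m$ then $(i,j+1)\in\mathcal{F}$; and if $(i,j)\in\mathcal{F}$ and $i>1$ then $(i-1,j)\in\mathcal{F}$. Let $c_j=|\{i:(i,j)\in\mathcal{F}\}|$. For $1\le d\le\min\{n,m\}$ and $0\le j\le d-1$ set $\kappa_j(\mathcal{F},d)=\sum_{t=1}^{m-d+1+j}\max\{c_t-j,0\}$ and $\kappa(\mathcal{F},d)=\min_j\kappa_j(\mathcal{F},d)$. For $1\le i\le m+n-1$, $D_i=\{(a,b)\in[n]\times[m]: b-a=m-i\}$. The pair $(\mathcal{F},d)$ is MDS-constructible if $\kappa(\mathcal{F},d)=\sum_{i=1}^{m+n-1}\max\{0,|D_i\cap\mathcal{F}|-d+1\}$. -}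

module Defs where

open import Data.Nat using (ℕ; zero; suc; _+_; _∸_; _≤_; _<_; _⊓_)
open import Data.Bool using (Bool; true; false; if_then_else_)
open import Data.List using (List; []; _∷_; map; upTo; foldr)
open import Data.Nat.ListAction using (sum)
open import Relation.Binary.PropositionalEquality using (_≡_)
open import Relation.Nullary.Decidable using (⌊_⌋)
open import Data.Nat using (_≟_)
open import Data.Bool using (_∧_)

-- A subset of ℕ × ℕ, given by its (decidable) characteristic function.
-- Coordinates are 1-indexed; only the values on [n] × [m] matter.
Diagram : Set
Diagram = ℕ → ℕ → Bool

range : ℕ → List ℕ
range k = map suc (upTo k)

sum1to : ℕ → (ℕ → ℕ) → ℕ
sum1to k f = sum (map f (range k))

b2n : Bool → ℕ
b2n true = 1
b2n false = 0

record IsFerrers (n m : ℕ) (F : Diagram) : Set where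
  field
    corner₁ : F 1 1 ≡ true
    corner₂ : F n m ≡ true
    right-closed : ∀ i j → 1 ≤ i → i ≤ n → 1 ≤ j → j < m →
                   F i j ≡ true → F i (suc j) ≡ true
    up-closed : ∀ i j → 1 < i → i ≤ n → 1 ≤ j → j ≤ m →
                F i j ≡ true → F (i ∸ 1) j ≡ true

col : ℕ → Diagram → ℕ → ℕ
col n F j = sum1to n (λ i → b2n (F i j))

κ-j : ℕ → ℕ → Diagram → ℕ → ℕ → ℕ
κ-j n m F d j = sum1to (m ∸ d + 1 + j) (λ t → col n F t ∸ j)

minWith : ℕ → List ℕ → ℕ
minWith = foldr _⊓_

-- κ(F,d) = min_{0 ≤ j ≤ d-1} κ_j(F,d)   (d ≥ 1, so j = 0 is in range)
κ : ℕ → ℕ → Diagram → ℕ → ℕ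
κ n m F d = minWith (κ-j n m F d 0) (map (κ-j n m F d) (upTo d))

-- |D_i ∩ F| where D_i = {(a,b) ∈ [n]×[m] : b - a = m - i}, i.e. b + i = a + m
diagSize : ℕ → ℕ → Diagram → ℕ → ℕ
diagSize n m F i =
  sum1to n (λ a → sum1to m (λ b → b2n (⌊ b + i ≟ a + m ⌋ ∧ F a b)))

diagBound : ℕ → ℕ → Diagram → ℕ → ℕ
diagBound n m F d = sum1to (m + n ∸ 1) (λ i → diagSize n m F i ∸ (d ∸ 1))

MDSConstructible : ℕ → ℕ → Diagram → ℕ → Set
MDSConstructible n m F d = κ n m F d ≡ diagBound n m F d

-- Write c_t for the column lengths and D_i for the diagonals of an n × n Ferrers
-- diagram F. Its first row and last column are full, so κ(F,2) = Σ_{t<n} c_t = |F| - n,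
-- the diagonals D_1, …, D_n meet F in the first row, and D_2, …, D_n meet it again
-- in the last column. Counting F by diagonals, Σ_i |D_i ∩ F| = |F|, so
-- MDS-constructibility of (F,2) says that exactly n diagonals are nonempty:
-- F has no cell below the main diagonal. Hence c_1 = 1, c_{n-1} ≤ n - 1
-- and |D_1 ∩ F| = 1, which make κ_1(F,3) = Σ_{t<n} (c_t - 1) the minimum defining
-- κ(F,3); and passing from d = 2 to d = 3 lowers both κ and the diagonal bound by
-- exactly n - 1, one for each of the columns 1, …, n-1 and the diagonals D_2, …, D_n.

module Submission where

open import Defs
open import Data.Nat using (ℕ; _≤_)
open import Data.Bool using (true; false; _∧_)
open import Data.List using ([_]; _++_; map; upTo)
open import Data.List.Properties using (map-++; upTo-∷ʳ)
open import Data.Nat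
open import Data.Nat.ListAction using (sum)
open import Data.Nat.ListAction.Properties using (sum-++)
open import Data.Nat.Properties
open import Algebra.Properties.CommutativeSemigroup +-commutativeSemigroup using (interchange)
open import Data.Sum using (inj₁; inj₂)
open import Function using (_∘_)
open import Relation.Binary.PropositionalEquality hiding ([_])
open import Relation.Nullary using (contradiction; yes; no)
open import Relation.Nullary.Decidable using (⌊_⌋; isYes≗does; dec-true; dec-false)

∑ : ℕ → (ℕ → ℕ) → ℕ
∑ zero    f = 0
∑ (suc k) f = ∑ k f + f (suc k)

sum1to-suc : ∀ k f → sum1to (suc k) f ≡ sum1to k f + f (suc k)
sum1to-suc k f = begin
  sum (map f (map suc (upTo (suc k))))
    ≡⟨ cong (λ xs → sum (map f (map suc xs))) (sym (upTo-∷ʳ k)) ⟩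
  sum (map f (map suc (upTo k ++ [ k ])))
    ≡⟨ cong (λ xs → sum (map f xs)) (map-++ suc (upTo k) [ k ]) ⟩
  sum (map f (map suc (upTo k) ++ [ suc k ]))
    ≡⟨ cong sum (map-++ f (map suc (upTo k)) [ suc k ]) ⟩
  sum (map f (map suc (upTo k)) ++ [ f (suc k) ])
    ≡⟨ sum-++ (map f (map suc (upTo k))) [ f (suc k) ] ⟩
  sum1to k f + (f (suc k) + 0)
    ≡⟨ cong (sum1to k f +_) (+-identityʳ (f (suc k))) ⟩
  sum1to k f + f (suc k) ∎
  where open ≡-Reasoning

sum1to≡∑ : ∀ k f → sum1to k f ≡ ∑ k f
sum1to≡∑ zero    f = refl
sum1to≡∑ (suc k) f = trans (sum1to-suc k f) (cong (_+ f (suc k)) (sum1to≡∑ k f))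

∑-cong : ∀ k {f g} → (∀ x → 1 ≤ x → x ≤ k → f x ≡ g x) → ∑ k f ≡ ∑ k g
∑-cong zero    f≗g = refl
∑-cong (suc k) f≗g =
  cong₂ _+_ (∑-cong k λ x 1≤x x≤k → f≗g x 1≤x (m≤n⇒m≤1+n x≤k)) (f≗g (suc k) (s≤s z≤n) ≤-refl)

∑-mono-≤ : ∀ k {f g} → (∀ x → 1 ≤ x → x ≤ k → f x ≤ g x) → ∑ k f ≤ ∑ k g
∑-mono-≤ zero    f≤g = z≤n
∑-mono-≤ (suc k) f≤g =
  +-mono-≤ (∑-mono-≤ k λ x 1≤x x≤k → f≤g x 1≤x (m≤n⇒m≤1+n x≤k)) (f≤g (suc k) (s≤s z≤n) ≤-refl)

∑-zero : ∀ k {f} → (∀ x → 1 ≤ x → x ≤ k → f x ≡ 0) → ∑ k f ≡ 0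
∑-zero zero    f≗0 = refl
∑-zero (suc k) f≗0 =
  cong₂ _+_ (∑-zero k λ x 1≤x x≤k → f≗0 x 1≤x (m≤n⇒m≤1+n x≤k)) (f≗0 (suc k) (s≤s z≤n) ≤-refl)

∑-one : ∀ k → ∑ k (λ _ → 1) ≡ k
∑-one zero    = refl
∑-one (suc k) = trans (cong (_+ 1) (∑-one k)) (+-comm k 1)

∑-distrib-+ : ∀ k f g → ∑ k (λ x → f x + g x) ≡ ∑ k f + ∑ k g
∑-distrib-+ zero    f g = refl
∑-distrib-+ (suc k) f g =
  trans (cong (_+ (f (suc k) + g (suc k))) (∑-distrib-+ k f g)) (interchange (∑ k f) (∑ k g) (f (suc k)) (g (suc k)))

∑-comm : ∀ k l (f : ℕ → ℕ → ℕ) → ∑ k (λ x → ∑ l (f x)) ≡ ∑ l (λ y → ∑ k (λ x → f x y))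
∑-comm zero    l f = sym (∑-zero l λ _ _ _ → refl)
∑-comm (suc k) l f = trans (cong (_+ ∑ l (f (suc k))) (∑-comm k l f))
                           (sym (∑-distrib-+ l (λ y → ∑ k (λ x → f x y)) (f (suc k))))

∑-split : ∀ k l f → ∑ (k + l) f ≡ ∑ k f + ∑ l (λ x → f (k + x))
∑-split k zero    f = trans (cong (λ z → ∑ z f) (+-identityʳ k)) (sym (+-identityʳ (∑ k f)))
∑-split k (suc l) f = begin
  ∑ (k + suc l) f                                ≡⟨ cong (λ z → ∑ z f) (+-suc k l) ⟩
  ∑ (k + l) f + f (suc (k + l))                  ≡⟨ cong₂ _+_ (∑-split k l f) (cong f (sym (+-suc k l))) ⟩
  ∑ k f + ∑ l (λ x → f (k + x)) + f (k + suc l)  ≡⟨ +-assoc (∑ k f) _ _ ⟩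
  ∑ k f + ∑ (suc l) (λ x → f (k + x))            ∎
  where open ≡-Reasoning

term≤∑ : ∀ k f {x} → 1 ≤ x → x ≤ k → f x ≤ ∑ k f
term≤∑ zero    f 1≤x x≤0 = contradiction (≤-trans 1≤x x≤0) λ ()
term≤∑ (suc k) f 1≤x x≤1+k with m≤n⇒m<n∨m≡n x≤1+k
... | inj₁ (s≤s x≤k) = ≤-trans (term≤∑ k f 1≤x x≤k) (m≤m+n (∑ k f) _)
... | inj₂ refl      = m≤n+m _ (∑ k f)

two-terms≤∑ : ∀ k f {x y} → 1 ≤ x → x < y → y ≤ k → f x + f y ≤ ∑ k f
two-terms≤∑ zero    f 1≤x x<y y≤0 = contradiction (≤-trans (≤-trans 1≤x (<⇒≤ x<y)) y≤0) λ ()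
two-terms≤∑ (suc k) f 1≤x x<y y≤1+k with m≤n⇒m<n∨m≡n y≤1+k
... | inj₁ (s≤s y≤k) = ≤-trans (two-terms≤∑ k f 1≤x x<y y≤k) (m≤m+n (∑ k f) _)
... | inj₂ refl      = +-monoˡ-≤ (f (suc k)) (term≤∑ k f 1≤x (≤-pred x<y))

∑≡0⇒term≡0 : ∀ k f {x} → ∑ k f ≡ 0 → 1 ≤ x → x ≤ k → f x ≡ 0
∑≡0⇒term≡0 k f ∑≡0 1≤x x≤k = n≤0⇒n≡0 (≤-trans (term≤∑ k f 1≤x x≤k) (≤-reflexive ∑≡0))

∸≡∸-suc+1 : ∀ x j → suc j ≤ x → x ∸ j ≡ (x ∸ suc j) + 1
∸≡∸-suc+1 (suc x) zero    _         = +-comm 1 x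
∸≡∸-suc+1 (suc x) (suc j) (s≤s j<x) = ∸≡∸-suc+1 x j j<x

∸≤∸-suc+1 : ∀ x j → x ∸ j ≤ (x ∸ suc j) + 1
∸≤∸-suc+1 zero    zero    = z≤n
∸≤∸-suc+1 zero    (suc j) = z≤n
∸≤∸-suc+1 (suc x) zero    = ≤-reflexive (+-comm 1 x)
∸≤∸-suc+1 (suc x) (suc j) = ∸≤∸-suc+1 x j

∑-∸-suc : ∀ k j {f : ℕ → ℕ} → (∀ x → 1 ≤ x → x ≤ k → suc j ≤ f x) →
          ∑ k (λ x → f x ∸ j) ≡ ∑ k (λ x → f x ∸ suc j) + k
∑-∸-suc k j {f} j<f = begin
  ∑ k (λ x → f x ∸ j)
    ≡⟨ ∑-cong k (λ x 1≤x x≤k → ∸≡∸-suc+1 (f x) j (j<f x 1≤x x≤k)) ⟩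
  ∑ k (λ x → (f x ∸ suc j) + 1)              ≡⟨ ∑-distrib-+ k (λ x → f x ∸ suc j) (λ _ → 1) ⟩
  ∑ k (λ x → f x ∸ suc j) + ∑ k (λ _ → 1)    ≡⟨ cong (∑ k (λ x → f x ∸ suc j) +_) (∑-one k) ⟩
  ∑ k (λ x → f x ∸ suc j) + k                ∎
  where open ≡-Reasoning

∑-∸-suc-≤ : ∀ k j (f : ℕ → ℕ) → ∑ k (λ x → f x ∸ j) ≤ ∑ k (λ x → f x ∸ suc j) + k
∑-∸-suc-≤ k j f = begin
  ∑ k (λ x → f x ∸ j)                        ≤⟨ ∑-mono-≤ k (λ x _ _ → ∸≤∸-suc+1 (f x) j) ⟩
  ∑ k (λ x → (f x ∸ suc j) + 1)              ≡⟨ ∑-distrib-+ k (λ x → f x ∸ suc j) (λ _ → 1) ⟩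
  ∑ k (λ x → f x ∸ suc j) + ∑ k (λ _ → 1)    ≡⟨ cong (∑ k (λ x → f x ∸ suc j) +_) (∑-one k) ⟩
  ∑ k (λ x → f x ∸ suc j) + k                ∎
  where open ≤-Reasoning

b2n≤1 : ∀ v → b2n v ≤ 1
b2n≤1 true  = ≤-refl
b2n≤1 false = z≤n

match-hit : ∀ {p q} v → p ≡ q → b2n (⌊ p ≟ q ⌋ ∧ v) ≡ b2n v
match-hit {p} {q} v p≡q =
  cong (λ t → b2n (t ∧ v)) (trans (isYes≗does (p ≟ q)) (dec-true (p ≟ q) p≡q))

match-miss : ∀ {p q} v → p ≢ q → b2n (⌊ p ≟ q ⌋ ∧ v) ≡ 0
match-miss {p} {q} v p≢q =
  cong (λ t → b2n (t ∧ v)) (trans (isYes≗does (p ≟ q)) (dec-false (p ≟ q) p≢q))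

∑-indicator : ∀ K b c v → b < c → c ≤ b + K → ∑ K (λ i → b2n (⌊ b + i ≟ c ⌋ ∧ v)) ≡ b2n v
∑-indicator zero    b c v b<c c≤b+0 =
  contradiction (<-≤-trans b<c (≤-trans c≤b+0 (≤-reflexive (+-identityʳ b)))) (<-irrefl refl)
∑-indicator (suc K) b c v b<c c≤b+1+K with c ≟ b + suc K
... | yes c≡b+1+K = cong₂ _+_ (∑-zero K λ x _ x≤K → match-miss v (<⇒≢ (b+x<c x≤K))) (match-hit v (sym c≡b+1+K))
  where
  b+x<c : ∀ {x} → x ≤ K → b + x < c
  b+x<c x≤K = <-≤-trans (+-monoʳ-< b (s≤s x≤K)) (≤-reflexive (sym c≡b+1+K))
... | no  c≢b+1+K = trans (cong₂ _+_ (∑-indicator K b c v b<c c≤b+K) (match-miss v (c≢b+1+K ∘ sym)))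
                          (+-identityʳ (b2n v))
  where
  c≤b+K : c ≤ b + K
  c≤b+K = ≤-pred (subst (c <_) (+-suc b K) (≤∧≢⇒< c≤b+1+K c≢b+1+K))

diagRow : ℕ → Diagram → ℕ → ℕ → ℕ
diagRow m F i a = ∑ m (λ b → b2n (⌊ b + i ≟ a + m ⌋ ∧ F a b))

diagSize≡∑diagRow : ∀ n m F i → diagSize n m F i ≡ ∑ n (diagRow m F i)
diagSize≡∑diagRow n m F i = trans (sum1to≡∑ n _) (∑-cong n λ a _ _ → sum1to≡∑ m _)

col≡∑ : ∀ n F t → col n F t ≡ ∑ n (λ a → b2n (F a t))
col≡∑ n F t = sum1to≡∑ n _

diagRow-pos : ∀ {m F i a b} → 1 ≤ b → b ≤ m → b + i ≡ a + m → F a b ≡ true →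
              1 ≤ diagRow m F i a
diagRow-pos {m} {F} {i} {a} {b} 1≤b b≤m onDiag Fab =
  subst (_≤ diagRow m F i a) (trans (match-hit (F a b) onDiag) (cong b2n Fab)) (term≤∑ m _ 1≤b b≤m)

diagSize-pos : ∀ {n m F i a b} → 1 ≤ a → a ≤ n → 1 ≤ b → b ≤ m → b + i ≡ a + m → F a b ≡ true →
               1 ≤ diagSize n m F i
diagSize-pos {n} {m} {F} {i} 1≤a a≤n 1≤b b≤m onDiag Fab =
  subst (1 ≤_) (sym (diagSize≡∑diagRow n m F i))
        (≤-trans (diagRow-pos {F = F} 1≤b b≤m onDiag Fab) (term≤∑ n (diagRow m F i) 1≤a a≤n))

∑diagSize≡∑col : ∀ n m F → ∑ (m + n) (diagSize (suc n) m F) ≡ ∑ m (col (suc n) F)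
∑diagSize≡∑col n m F = begin
  ∑ (m + n) (diagSize N m F)
    ≡⟨ ∑-cong (m + n) (λ i _ _ → diagSize≡∑diagRow N m F i) ⟩
  ∑ (m + n) (λ i → ∑ N (λ a → ∑ m (λ b → cell i a b)))
    ≡⟨ ∑-comm (m + n) N (λ i a → ∑ m (λ b → cell i a b)) ⟩
  ∑ N (λ a → ∑ (m + n) (λ i → ∑ m (λ b → cell i a b)))
    ≡⟨ ∑-cong N (λ a _ _ → ∑-comm (m + n) m (λ i b → cell i a b)) ⟩
  ∑ N (λ a → ∑ m (λ b → ∑ (m + n) (λ i → cell i a b)))
    ≡⟨ ∑-cong N (λ a 1≤a a≤N → ∑-cong m λ b 1≤b b≤m →
         ∑-indicator (m + n) b (a + m) (F a b) (b<a+m 1≤a b≤m) (a+m≤b+[m+n] a≤N 1≤b)) ⟩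
  ∑ N (λ a → ∑ m (λ b → b2n (F a b)))
    ≡⟨ ∑-comm N m (λ a b → b2n (F a b)) ⟩
  ∑ m (λ b → ∑ N (λ a → b2n (F a b)))
    ≡⟨ ∑-cong m (λ b _ _ → sym (col≡∑ N F b)) ⟩
  ∑ m (col N F) ∎
  where
  open ≡-Reasoning
  N : ℕ
  N = suc n
  cell : ℕ → ℕ → ℕ → ℕ
  cell i a b = b2n (⌊ b + i ≟ a + m ⌋ ∧ F a b)
  b<a+m : ∀ {a b} → 1 ≤ a → b ≤ m → b < a + m
  b<a+m 1≤a b≤m = <-≤-trans (s≤s b≤m) (+-monoˡ-≤ m 1≤a)
  a+m≤b+[m+n] : ∀ {a b} → a ≤ N → 1 ≤ b → a + m ≤ b + (m + n)
  a+m≤b+[m+n] {a} {b} a≤N 1≤b =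
    ≤-trans (+-monoˡ-≤ m a≤N) (subst (_≤ b + (m + n)) (cong suc (+-comm m n)) (+-monoˡ-≤ (m + n) 1≤b))

diagSize-first≤1 : ∀ n m F → diagSize (suc n) (suc m) F 1 ≤ 1
diagSize-first≤1 n m F = begin
  diagSize (suc n) (suc m) F 1           ≡⟨ diagSize≡∑diagRow (suc n) (suc m) F 1 ⟩
  ∑ (1 + n) row                          ≡⟨ ∑-split 1 n row ⟩
  row 1 + ∑ n (λ x → row (suc x))
    ≡⟨ cong (row 1 +_) (∑-zero n λ x 1≤x _ → ∑-zero (suc m) λ b _ b≤1+m →
         match-miss (F (suc x) b) (<⇒≢ (lower-row 1≤x b≤1+m))) ⟩
  row 1 + 0                              ≡⟨ +-identityʳ (row 1) ⟩
  ∑ m (cell 1) + cell 1 (suc m)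
    ≡⟨ cong (_+ cell 1 (suc m)) (∑-zero m λ b _ b≤m → match-miss (F 1 b) (<⇒≢ (first-row b≤m))) ⟩
  cell 1 (suc m)                         ≤⟨ b2n≤1 _ ⟩
  1                                      ∎
  where
  open ≤-Reasoning
  row : ℕ → ℕ
  row = diagRow (suc m) F 1
  cell : ℕ → ℕ → ℕ
  cell a b = b2n (⌊ b + 1 ≟ a + suc m ⌋ ∧ F a b)
  lower-row : ∀ {x b} → 1 ≤ x → b ≤ suc m → b + 1 < suc x + suc m
  lower-row {x} 1≤x b≤1+m = s≤s (≤-trans (+-mono-≤ b≤1+m 1≤x) (≤-reflexive (+-comm (suc m) x)))
  first-row : ∀ {b} → b ≤ m → b + 1 < 1 + suc m
  first-row {b} b≤m = s≤s (≤-trans (+-monoˡ-≤ 1 b≤m) (≤-reflexive (+-comm m 1)))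

module _ {n m : ℕ} {F : Diagram} (isF : IsFerrers n m F) where
  open IsFerrers isF

  first-row-full : 1 ≤ n → ∀ {b} → 1 ≤ b → b ≤ m → F 1 b ≡ true
  first-row-full 1≤n {suc zero}    _ _   = corner₁
  first-row-full 1≤n {suc (suc b)} _ b<m =
    right-closed 1 (suc b) ≤-refl 1≤n (s≤s z≤n) b<m (first-row-full 1≤n (s≤s z≤n) (<⇒≤ b<m))

  last-column-full : 1 ≤ m → ∀ {a} → 1 ≤ a → a ≤ n → F a m ≡ true
  last-column-full 1≤m {a} 1≤a a≤n = down-to a (n ∸ a) 1≤a (m+[n∸m]≡n a≤n)
    where
    down-to : ∀ a d → 1 ≤ a → a + d ≡ n → F a m ≡ true
    down-to a zero    _   a+0≡n = subst (λ x → F x m ≡ true) (trans (sym a+0≡n) (+-identityʳ a)) corner₂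
    down-to a (suc d) 1≤a a+1+d≡n =
      up-closed (suc a) m (s≤s 1≤a) 1+a≤n 1≤m ≤-refl
                (down-to (suc a) d (s≤s z≤n) (trans (sym (+-suc a d)) a+1+d≡n))
      where
      1+a≤n : suc a ≤ n
      1+a≤n = subst (suc a ≤_) a+1+d≡n (subst (_≤ a + suc d) (+-comm a 1) (+-monoʳ-≤ a (s≤s z≤n)))

  col-pos : 1 ≤ n → ∀ {t} → 1 ≤ t → t ≤ m → 1 ≤ col n F t
  col-pos 1≤n {t} 1≤t t≤m =
    subst (1 ≤_) (sym (col≡∑ n F t))
          (subst (λ v → b2n v ≤ ∑ n cell) (first-row-full 1≤n 1≤t t≤m) (term≤∑ n cell ≤-refl 1≤n))
    where
    cell : ℕ → ℕ
    cell a = b2n (F a t)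

  col-last : 1 ≤ m → col n F m ≡ n
  col-last 1≤m = begin
    col n F m                    ≡⟨ col≡∑ n F m ⟩
    ∑ n (λ a → b2n (F a m))      ≡⟨ ∑-cong n (λ a 1≤a a≤n → cong b2n (last-column-full 1≤m 1≤a a≤n)) ⟩
    ∑ n (λ _ → 1)                ≡⟨ ∑-one n ⟩
    n                            ∎
    where open ≡-Reasoning

  diagRow-first-pos : 1 ≤ n → ∀ {i} → 1 ≤ i → i ≤ m → 1 ≤ diagRow m F i 1
  diagRow-first-pos 1≤n {suc j} _ j<m =
    diagRow-pos {F = F} 1≤m∸j (m∸n≤m m j) onDiag (first-row-full 1≤n 1≤m∸j (m∸n≤m m j))
    where
    1≤m∸j : 1 ≤ m ∸ j
    1≤m∸j = m<n⇒0<n∸m j<m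
    onDiag : m ∸ j + suc j ≡ 1 + m
    onDiag = trans (+-suc (m ∸ j) j) (cong suc (m∸n+n≡m (<⇒≤ j<m)))

  diagRow-own-pos : 1 ≤ m → ∀ {i} → 1 ≤ i → i ≤ n → 1 ≤ diagRow m F i i
  diagRow-own-pos 1≤m {i} 1≤i i≤n =
    diagRow-pos {F = F} 1≤m ≤-refl (+-comm m i) (last-column-full 1≤m 1≤i i≤n)

  diagSize-upper-pos : 1 ≤ n → ∀ {i} → 1 ≤ i → i ≤ m → 1 ≤ diagSize n m F i
  diagSize-upper-pos 1≤n {i} 1≤i i≤m =
    subst (1 ≤_) (sym (diagSize≡∑diagRow n m F i))
          (≤-trans (diagRow-first-pos 1≤n 1≤i i≤m) (term≤∑ n (diagRow m F i) ≤-refl 1≤n))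

  diagSize-≥2 : ∀ {i} → 2 ≤ i → i ≤ n → i ≤ m → 2 ≤ diagSize n m F i
  diagSize-≥2 {i} 2≤i i≤n i≤m =
    subst (2 ≤_) (sym (diagSize≡∑diagRow n m F i))
          (≤-trans (+-mono-≤ (diagRow-first-pos 1≤n 1≤i i≤m) (diagRow-own-pos 1≤m 1≤i i≤n))
                   (two-terms≤∑ n (diagRow m F i) ≤-refl 2≤i i≤n))
    where
    1≤i : 1 ≤ i
    1≤i = ≤-trans (s≤s z≤n) 2≤i
    1≤n : 1 ≤ n
    1≤n = ≤-trans 1≤i i≤n
    1≤m : 1 ≤ m
    1≤m = ≤-trans 1≤i i≤m

upper-triangular⇒col≤ : ∀ n F {t} → (∀ {a} → t < a → a ≤ n → F a t ≡ false) → t ≤ n → col n F t ≤ t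
upper-triangular⇒col≤ n F {t} below t≤n = begin
  col n F t                               ≡⟨ col≡∑ n F t ⟩
  ∑ n cell                                ≡⟨ cong (λ L → ∑ L cell) (sym (m+[n∸m]≡n t≤n)) ⟩
  ∑ (t + (n ∸ t)) cell                    ≡⟨ ∑-split t (n ∸ t) cell ⟩
  ∑ t cell + ∑ (n ∸ t) (λ x → cell (t + x))
    ≡⟨ cong (∑ t cell +_) (∑-zero (n ∸ t) λ x 1≤x x≤n∸t →
         cong b2n (below (m<m+n t 1≤x) (subst (t + x ≤_) (m+[n∸m]≡n t≤n) (+-monoʳ-≤ t x≤n∸t)))) ⟩
  ∑ t cell + 0                            ≡⟨ +-identityʳ (∑ t cell) ⟩
  ∑ t cell                                ≤⟨ ∑-mono-≤ t (λ a _ _ → b2n≤1 (F a t)) ⟩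
  ∑ t (λ _ → 1)                           ≡⟨ ∑-one t ⟩
  t                                       ∎
  where
  open ≤-Reasoning
  cell : ℕ → ℕ
  cell a = b2n (F a t)

κ-j-square : ∀ d l F j →
             κ-j (d + l) (d + l) F d j ≡ ∑ (suc (j + l)) (λ t → col (d + l) F t ∸ j)
κ-j-square d l F j =
  trans (sum1to≡∑ (d + l ∸ d + 1 + j) _) (cong (λ L → ∑ L (λ t → col (d + l) F t ∸ j)) length≡)
  where
  length≡ : d + l ∸ d + 1 + j ≡ suc (j + l)
  length≡ = trans (cong (λ x → x + 1 + j) (m+n∸m≡n d l))
                  (trans (cong (_+ j) (+-comm l 1)) (cong suc (+-comm l j)))

diagBound≡∑ : ∀ k F d → diagBound (suc k) (suc k) F d ≡
                         ∑ (suc k + k) (λ i → diagSize (suc k) (suc k) F i ∸ (d ∸ 1))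
diagBound≡∑ k F d =
  trans (sum1to≡∑ (k + suc k) _) (cong (λ L → ∑ L (λ i → diagSize (suc k) (suc k) F i ∸ (d ∸ 1))) (+-suc k k))

κ₂≡∑col : ∀ l {F} → IsFerrers (2 + l) (2 + l) F → κ (2 + l) (2 + l) F 2 ≡ ∑ (suc l) (col (2 + l) F)
κ₂≡∑col l {F} isF = begin
  κ-j N N F 2 0 ⊓ (κ-j N N F 2 1 ⊓ κ-j N N F 2 0)
    ≡⟨ cong₂ (λ u v → u ⊓ (v ⊓ u)) (κ-j-square 2 l F 0) κ₁≡ ⟩
  P ⊓ (P ⊓ P)                                       ≡⟨ cong (P ⊓_) (⊓-idem P) ⟩
  P ⊓ P                                             ≡⟨ ⊓-idem P ⟩
  P                                                 ∎
  where
  open ≡-Reasoning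
  N P : ℕ
  N = 2 + l
  P = ∑ (suc l) (col N F)
  κ₁≡ : κ-j N N F 2 1 ≡ P
  κ₁≡ = begin
    κ-j N N F 2 1
      ≡⟨ κ-j-square 2 l F 1 ⟩
    ∑ (suc l) (λ t → col N F t ∸ 1) + (col N F N ∸ 1)
      ≡⟨ cong (λ x → ∑ (suc l) (λ t → col N F t ∸ 1) + (x ∸ 1)) (col-last isF (s≤s z≤n)) ⟩
    ∑ (suc l) (λ t → col N F t ∸ 1) + suc l
      ≡⟨ ∑-∸-suc (suc l) 0 (λ t 1≤t t≤1+l → col-pos isF (s≤s z≤n) 1≤t (m≤n⇒m≤1+n t≤1+l)) ⟨
    P ∎

1⊓x≡0⇒x≡0 : ∀ {x} → 1 ⊓ x ≡ 0 → x ≡ 0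
1⊓x≡0⇒x≡0 {zero} _ = refl

module FromMDS₂ (m : ℕ) {F : Diagram} (isF : IsFerrers (3 + m) (3 + m) F)
                (mds₂ : MDSConstructible (3 + m) (3 + m) F 2) where
  private
    n k : ℕ
    n = 3 + m
    k = 2 + m
    c : ℕ → ℕ
    c = col n F
    D : ℕ → ℕ
    D = diagSize n n F

  nonempty-diagonals : ∑ (n + k) (λ i → 1 ⊓ D i) ≡ n
  nonempty-diagonals = +-cancelʳ-≡ (∑ k c) _ _ (begin
    ∑ (n + k) (λ i → 1 ⊓ D i) + ∑ k c
      ≡⟨ cong (∑ (n + k) (λ i → 1 ⊓ D i) +_)
              (trans (sym (κ₂≡∑col (suc m) isF)) (trans mds₂ (diagBound≡∑ k F 2))) ⟩
    ∑ (n + k) (λ i → 1 ⊓ D i) + ∑ (n + k) (λ i → D i ∸ 1)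
      ≡⟨ sym (∑-distrib-+ (n + k) (λ i → 1 ⊓ D i) (λ i → D i ∸ 1)) ⟩
    ∑ (n + k) (λ i → 1 ⊓ D i + (D i ∸ 1))
      ≡⟨ ∑-cong (n + k) (λ i _ _ → m⊓n+n∸m≡n 1 (D i)) ⟩
    ∑ (n + k) D
      ≡⟨ ∑diagSize≡∑col k n F ⟩
    ∑ k c + c n
      ≡⟨ cong (∑ k c +_) (col-last isF (s≤s z≤n)) ⟩
    ∑ k c + n
      ≡⟨ +-comm (∑ k c) n ⟩
    n + ∑ k c ∎)
    where open ≡-Reasoning

  lower-diagonals-empty : ∀ {x} → 1 ≤ x → x ≤ k → D (n + x) ≡ 0
  lower-diagonals-empty 1≤x x≤k =
    1⊓x≡0⇒x≡0 (∑≡0⇒term≡0 k (λ x → 1 ⊓ D (n + x)) lower≡0 1≤x x≤k)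
    where
    open ≡-Reasoning
    upper≡n : ∑ n (λ i → 1 ⊓ D i) ≡ n
    upper≡n = trans (∑-cong n λ i 1≤i i≤n → m≤n⇒m⊓n≡m (diagSize-upper-pos isF (s≤s z≤n) 1≤i i≤n))
                    (∑-one n)
    lower≡0 : ∑ k (λ x → 1 ⊓ D (n + x)) ≡ 0
    lower≡0 = +-cancelˡ-≡ n _ _ (begin
      n + ∑ k (λ x → 1 ⊓ D (n + x))                    ≡⟨ cong (_+ ∑ k (λ x → 1 ⊓ D (n + x))) upper≡n ⟨
      ∑ n (λ i → 1 ⊓ D i) + ∑ k (λ x → 1 ⊓ D (n + x))  ≡⟨ ∑-split n k (λ i → 1 ⊓ D i) ⟨
      ∑ (n + k) (λ i → 1 ⊓ D i)                        ≡⟨ nonempty-diagonals ⟩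
      n                                                ≡⟨ +-identityʳ n ⟨
      n + 0                                            ∎)

  below-diagonal-empty : ∀ {a b} → 1 ≤ b → b < a → a ≤ n → F a b ≡ false
  below-diagonal-empty {a} {b} 1≤b b<a a≤n with F a b in Fab
  ... | false = refl
  ... | true  = contradiction (subst (1 ≤_) (lower-diagonals-empty 1≤a∸b a∸b≤k) cell) λ ()
    where
    1≤a∸b : 1 ≤ a ∸ b
    1≤a∸b = m<n⇒0<n∸m b<a
    a∸b≤k : a ∸ b ≤ k
    a∸b≤k = ∸-mono a≤n 1≤b
    onDiag : b + (n + (a ∸ b)) ≡ a + n
    onDiag = trans (cong (b +_) (+-comm n (a ∸ b)))
                   (trans (sym (+-assoc b (a ∸ b) n)) (cong (_+ n) (m+[n∸m]≡n (<⇒≤ b<a))))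
    cell : 1 ≤ D (n + (a ∸ b))
    cell = diagSize-pos (≤-trans (s≤s z≤n) b<a) a≤n 1≤b (≤-trans (<⇒≤ b<a) a≤n) onDiag Fab

  col≤ : ∀ {t} → 1 ≤ t → t ≤ n → c t ≤ t
  col≤ 1≤t t≤n = upper-triangular⇒col≤ n F (λ t<a a≤n → below-diagonal-empty 1≤t t<a a≤n) t≤n

  diagBound≡∑upper : ∀ d → 2 ≤ d → diagBound n n F d ≡ ∑ k (λ x → D (suc x) ∸ (d ∸ 1))
  diagBound≡∑upper d 2≤d = begin
    diagBound n n F d                      ≡⟨ diagBound≡∑ k F d ⟩
    ∑ (n + k) excess                       ≡⟨ ∑-split n k excess ⟩
    ∑ n excess + ∑ k (λ x → excess (n + x))
      ≡⟨ cong (∑ n excess +_) (∑-zero k λ x 1≤x x≤k →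
           trans (cong (_∸ (d ∸ 1)) (lower-diagonals-empty 1≤x x≤k)) (0∸n≡0 (d ∸ 1))) ⟩
    ∑ n excess + 0                         ≡⟨ +-identityʳ (∑ n excess) ⟩
    ∑ (1 + k) excess                       ≡⟨ ∑-split 1 k excess ⟩
    excess 1 + ∑ k (λ x → excess (suc x))  ≡⟨ cong (_+ ∑ k (λ x → excess (suc x))) excess₁≡0 ⟩
    ∑ k (λ x → excess (suc x))             ∎
    where
    open ≡-Reasoning
    excess : ℕ → ℕ
    excess i = D i ∸ (d ∸ 1)
    excess₁≡0 : excess 1 ≡ 0
    excess₁≡0 = m≤n⇒m∸n≡0 (≤-trans (diagSize-first≤1 k k F) (∸-monoˡ-≤ 1 2≤d))

  diagBound₂≡diagBound₃+k : diagBound n n F 2 ≡ diagBound n n F 3 + k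
  diagBound₂≡diagBound₃+k = begin
    diagBound n n F 2
      ≡⟨ diagBound≡∑upper 2 ≤-refl ⟩
    ∑ k (λ x → D (suc x) ∸ 1)
      ≡⟨ ∑-∸-suc k 1 (λ x 1≤x x≤k → diagSize-≥2 isF (s≤s 1≤x) (s≤s x≤k) (s≤s x≤k)) ⟩
    ∑ k (λ x → D (suc x) ∸ 2) + k
      ≡⟨ cong (_+ k) (diagBound≡∑upper 3 (s≤s (s≤s z≤n))) ⟨
    diagBound n n F 3 + k ∎
    where open ≡-Reasoning

  ∑col∸1≤∑col : ∑ k (λ t → c t ∸ 1) ≤ ∑ (suc m) c
  ∑col∸1≤∑col = begin
    ∑ (suc m) (λ t → c t ∸ 1) + (c k ∸ 1)
      ≤⟨ +-monoʳ-≤ (∑ (suc m) (λ t → c t ∸ 1)) (∸-monoˡ-≤ 1 (col≤ (s≤s z≤n) (n≤1+n k))) ⟩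
    ∑ (suc m) (λ t → c t ∸ 1) + suc m
      ≡⟨ ∑-∸-suc (suc m) 0 (λ t 1≤t t≤1+m →
           col-pos isF (s≤s z≤n) 1≤t (m≤n⇒m≤1+n (m≤n⇒m≤1+n t≤1+m))) ⟨
    ∑ (suc m) c ∎
    where open ≤-Reasoning

  ∑col∸1≤∑col∸2 : ∑ k (λ t → c t ∸ 1) ≤ ∑ n (λ t → c t ∸ 2)
  ∑col∸1≤∑col∸2 = begin
    ∑ (1 + suc m) (λ t → c t ∸ 1)
      ≡⟨ ∑-split 1 (suc m) (λ t → c t ∸ 1) ⟩
    (c 1 ∸ 1) + ∑ (suc m) (λ x → c (suc x) ∸ 1)
      ≡⟨ cong (_+ ∑ (suc m) (λ x → c (suc x) ∸ 1)) (m≤n⇒m∸n≡0 (col≤ ≤-refl (s≤s z≤n))) ⟩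
    ∑ (suc m) (λ x → c (suc x) ∸ 1)
      ≤⟨ ∑-∸-suc-≤ (suc m) 1 (c ∘ suc) ⟩
    ∑ (suc m) (λ x → c (suc x) ∸ 2) + suc m
      ≤⟨ +-monoˡ-≤ (suc m) (m≤n+m _ (c 1 ∸ 2)) ⟩
    (c 1 ∸ 2) + ∑ (suc m) (λ x → c (suc x) ∸ 2) + suc m
      ≡⟨ cong₂ _+_ (∑-split 1 (suc m) (λ t → c t ∸ 2)) (cong (_∸ 2) (col-last isF (s≤s z≤n))) ⟨
    ∑ n (λ t → c t ∸ 2) ∎
    where open ≤-Reasoning

  κ₃≡∑col∸1 : κ n n F 3 ≡ ∑ k (λ t → c t ∸ 1)
  κ₃≡∑col∸1 = begin
    κ₀ ⊓ (κ₁ ⊓ (κ₂ ⊓ κ₀))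
      ≡⟨ cong₂ (λ u w → u ⊓ (κ₁ ⊓ (w ⊓ u))) (κ-j-square 3 m F 0) (κ-j-square 3 m F 2) ⟩
    R ⊓ (κ₁ ⊓ (K ⊓ R))          ≡⟨ cong (λ v → R ⊓ (v ⊓ (K ⊓ R))) (κ-j-square 3 m F 1) ⟩
    R ⊓ (Q ⊓ (K ⊓ R))
      ≡⟨ cong (R ⊓_) (m≤n⇒m⊓n≡m (⊓-glb ∑col∸1≤∑col∸2 ∑col∸1≤∑col)) ⟩
    R ⊓ Q                       ≡⟨ m≥n⇒m⊓n≡n ∑col∸1≤∑col ⟩
    Q                           ∎
    where
    open ≡-Reasoning
    κ₀ κ₁ κ₂ Q R K : ℕ
    κ₀ = κ-j n n F 3 0
    κ₁ = κ-j n n F 3 1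
    κ₂ = κ-j n n F 3 2
    Q = ∑ k (λ t → c t ∸ 1)
    R = ∑ (suc m) c
    K = ∑ n (λ t → c t ∸ 2)

corollary5p8 : (n : ℕ) → 3 ≤ n → (F : Diagram) → IsFerrers n n F →
               MDSConstructible n n F 2 → MDSConstructible n n F 3
corollary5p8 (suc zero)          (s≤s ())       _ _   _
corollary5p8 (suc (suc zero))    (s≤s (s≤s ())) _ _   _
corollary5p8 (suc (suc (suc m))) _              F isF mds₂ = +-cancelʳ-≡ k _ _ (begin
  κ n n F 3 + k                   ≡⟨ cong (_+ k) κ₃≡∑col∸1 ⟩
  ∑ k (λ t → col n F t ∸ 1) + k
    ≡⟨ ∑-∸-suc k 0 (λ t 1≤t t≤k → col-pos isF (s≤s z≤n) 1≤t (m≤n⇒m≤1+n t≤k)) ⟨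
  ∑ k (col n F)                   ≡⟨ κ₂≡∑col (suc m) isF ⟨
  κ n n F 2                       ≡⟨ mds₂ ⟩
  diagBound n n F 2               ≡⟨ diagBound₂≡diagBound₃+k ⟩
  diagBound n n F 3 + k           ∎)
  where
  open ≡-Reasoning
  open FromMDS₂ m isF mds₂
  n k : ℕ
  n = 3 + m
  k = 2 + m
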